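{- Let $l\ge0$ be an integer and $v\in\{0,1\}$. Let $\mathcal{D}_{2l+v}$ be the set of partitions into exactly $2l+v$ distinct parts, and for $\pi=(\lambda_1,\lambda_2,\dots)$ let $\mathcal{O}(\pi)=\lambda_1+\lambda_3+\lambda_5+\cdots$. Let $\mathcal{P}_{M}(k,2)$ be the set of partitions $(\lambda_1,\dots,\lambda_M)$ into exactly $M$ parts with $\lambda_M\ge k$ and $\lambda_i-\lambda_{i+1}\ge2$ for $1\le i\le M-1$ ($\mathcal{P}_0(k,2)$ containing only the empty partition). For a partition $\pi=(\lambda_1,\dots,\lambda_M)$ with $M\ge1$ define \[\omega_{2,2}(\pi)=(\lambda_M-1)\prod_{i=1}^{M-1}(\lambda_i-\lambda_{i+1}-1),\qquad \tilde\omega_1(\pi)=\prod_{i=1}^{M-1}(\lambda_i-\lambda_{i+1}-1),\] and let $\omega_{2,2}$ of the empty partition be $1$. Then \[\sum_{\pi\in\mathcal{D}_{2l+v}}q^{\mathcal{O}(\pi)}=\sum_{\pi\in\mathcal{P}_{l+v}(2-v,2)}\big[(1-v)\,\omega_{2,2}(\pi)+v\,\tilde\omega_1(\pi)\big]q^{|\pi|}.\]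
   Context: A partition is a finite weakly decreasing sequence of positive integers, written $(\lambda_1,\lambda_2,\dots)$ with $\lambda_1\ge\lambda_2\ge\cdots$; $|\pi|$ is the sum of its parts. -}

module Defs where

open import Data.Nat using (ℕ; zero; suc; _+_; _*_; _∸_; _≤_; _<_)
open import Data.List using (List; []; _∷_; length)
open import Data.List.Relation.Unary.All using (All)
open import Data.List.Relation.Unary.Linked using (Linked)
open import Data.Product using (_×_)
open import Data.Unit using (⊤)
open import Relation.Binary.PropositionalEquality using (_≡_)

IsPartition : List ℕ → Set
IsPartition π = All (λ x → 0 < x) π × Linked (λ a b → b ≤ a) π

InD : ℕ → List ℕ → Set
InD m π = IsPartition π × Linked (λ a b → b < a) π × length π ≡ m

mutual
  oddSum : List ℕ → ℕ
  oddSum []       = 0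
  oddSum (x ∷ xs) = x + evenSum xs

  evenSum : List ℕ → ℕ
  evenSum []       = 0
  evenSum (x ∷ xs) = oddSum xs

LastGe : ℕ → List ℕ → Set
LastGe k []           = ⊤
LastGe k (x ∷ [])     = k ≤ x
LastGe k (x ∷ y ∷ ys) = LastGe k (y ∷ ys)

InP : ℕ → ℕ → List ℕ → Set
InP M k π = IsPartition π × length π ≡ M × LastGe k π
          × Linked (λ a b → 2 + b ≤ a) π

gapProd : List ℕ → ℕ
gapProd []           = 1
gapProd (x ∷ [])     = 1
gapProd (x ∷ y ∷ ys) = (x ∸ y ∸ 1) * gapProd (y ∷ ys)

lastOf : ℕ → List ℕ → ℕ
lastOf x []       = x
lastOf x (y ∷ ys) = lastOf y ys

ω22 : List ℕ → ℕ
ω22 []       = 1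
ω22 (x ∷ xs) = (lastOf x xs ∸ 1) * gapProd (x ∷ xs)

ω̃1 : List ℕ → ℕ
ω̃1 = gapProd

weight : ℕ → List ℕ → ℕ
weight v π = (1 ∸ v) * ω22 π + v * ω̃1 π

module Submission where

-- Reading off the odd-indexed parts μ = (λ₁, λ₃, λ₅, …) of a
-- partition π into 2l+v distinct parts (v ≤ 1) gives a partition with l+v
-- parts, |μ| = 𝒪(π), consecutive parts differing by ≥ 2 and last part
-- ≥ 2−v, i.e. μ ∈ 𝒫_{l+v}(2−v,2).  Conversely π is recovered from μ by
-- choosing each even-indexed part independently, strictly between two
-- consecutive parts of μ (and, when v = 0, the last one strictly between
-- μ_l and 0).  So the fibre over μ has ∏(μᵢ − μᵢ₊₁ − 1) · (μ_l − 1)^{1−v}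
-- = weight v μ elements, and the q^n-coefficient of the left side (the
-- length of L₁) is the total size of the fibres over the partitions in L₂.

open import Defs
open import Data.Nat using (ℕ; zero; suc; _+_; _*_; _∸_; _≤_; _<_; z≤n; s≤s)
open import Data.Nat.Properties
open import Data.Nat.ListAction using (sum)
open import Data.Nat.Tactic.RingSolver using (solve-∀)
open import Algebra.Properties.CommutativeSemigroup *-commutativeSemigroup using (x∙yz≈y∙xz)
open import Data.List using (List; []; _∷_; length; map; concatMap; applyUpTo; cartesianProductWith)
open import Data.List.Properties using (length-++; length-map; length-applyUpTo)
open import Data.List.Membership.Propositional using (_∈_; find; lose)
open import Data.List.Membership.Propositional.Properties
  using (∈-concatMap⁺; ∈-concatMap⁻; ∈-applyUpTo⁺; ∈-applyUpTo⁻; ∈-cartesianProductWith⁺; ∈-cartesianProductWith⁻)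
open import Data.List.Membership.Propositional.Properties.WithK using (unique∧set⇒bag)
open import Data.List.Relation.Binary.BagAndSetEquality using (∼bag⇒↭)
open import Data.List.Relation.Binary.Permutation.Propositional.Properties using (↭-length)
open import Data.List.Relation.Unary.Unique.Propositional using (Unique)
open import Data.List.Relation.Unary.Unique.Propositional.Properties
  using (++⁺; applyUpTo⁺₁; cartesianProductWith⁺)
open import Data.List.Relation.Unary.All as All using (All; []; _∷_)
open import Data.List.Relation.Unary.Any using (here; there)
open import Data.List.Relation.Unary.AllPairs using ([]; _∷_)
open import Data.List.Relation.Unary.Linked as Linked using (Linked; []; [-]; _∷_)
open import Data.Product using (_×_; _,_; Σ)
open import Data.Unit using (tt)
open import Data.Empty using (⊥)
open import Function.Bundles using (_⇔_; mk⇔; Equivalence)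
open import Function.Properties.Equivalence using () renaming (trans to ⇔-trans; sym to ⇔-sym)
open import Relation.Nullary using (contradiction)
open import Relation.Binary.PropositionalEquality

Positive : List ℕ → Set
Positive = All (λ x → 0 < x)

Decreasing : List ℕ → Set
Decreasing = Linked (λ a b → b < a)

Gapped : List ℕ → Set
Gapped = Linked (λ a b → 2 + b ≤ a)

sameLength : ∀ {A : Set} {xs ys : List A} → Unique xs → Unique ys
           → (∀ {x} → (x ∈ xs) ⇔ (x ∈ ys)) → length xs ≡ length ys
sameLength uxs uys same = ↭-length (∼bag⇒↭ (unique∧set⇒bag uxs uys same))

-- Concatenating duplicate-free lists f x over a duplicate-free list of
-- indices x stays duplicate-free when each x can be read back (by g) from
-- every element of f x: the blocks are then pairwise disjoint.
concatMap-unique : ∀ {A B : Set} (f : A → List B) (g : B → A)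
                 → (∀ x y → y ∈ f x → g y ≡ x)
                 → ∀ {xs} → Unique xs → (∀ x → x ∈ xs → Unique (f x))
                 → Unique (concatMap f xs)
concatMap-unique f g label {[]} _ _ = []
concatMap-unique f g label {x ∷ xs} (x∉xs ∷ uxs) ufs =
  ++⁺ (ufs x (here refl)) (concatMap-unique f g label uxs (λ y p → ufs y (there p))) disjoint
  where
  disjoint : ∀ {z} → z ∈ f x × z ∈ concatMap f xs → ⊥
  disjoint {z} (z∈fx , z∈rest) with find (∈-concatMap⁻ f {xs} z∈rest)
  ... | y , y∈xs , z∈fy = All.lookup x∉xs y∈xs (trans (sym (label x z z∈fx)) (label y z z∈fy))

length-concatMap : ∀ {A B : Set} (f : A → List B) (w : A → ℕ) {xs}
                 → (∀ x → x ∈ xs → length (f x) ≡ w x)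
                 → length (concatMap f xs) ≡ sum (map w xs)
length-concatMap f w {[]} _ = refl
length-concatMap f w {x ∷ xs} sizes =
  trans (length-++ (f x))
        (cong₂ _+_ (sizes x (here refl)) (length-concatMap f w (λ y p → sizes y (there p))))

length-cartesianProductWith : ∀ {A B C : Set} (f : A → B → C) xs (ys : List B)
  → length (cartesianProductWith f xs ys) ≡ length xs * length ys
length-cartesianProductWith f [] ys = refl
length-cartesianProductWith f (x ∷ xs) ys =
  trans (length-++ (map (f x) ys))
        (cong₂ _+_ (length-map (f x) ys) (length-cartesianProductWith f xs ys))

between : ℕ → ℕ → List ℕ
between b a = applyUpTo (suc b +_) (a ∸ suc b)

∈-between⁻ : ∀ {b a e} → e ∈ between b a → b < e × e < a
∈-between⁻ {b} {a} e∈ with ∈-applyUpTo⁻ (suc b +_) e∈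
... | i , i<len , refl = s≤s (m≤m+n b i) , (begin-strict
      suc b + i            <⟨ +-monoʳ-< (suc b) i<len ⟩
      suc b + (a ∸ suc b)  ≡⟨ m+[n∸m]≡n (<⇒≤ (m∸n≢0⇒n<m {a} {suc b} nonempty)) ⟩
      a                    ∎)
  where
  open ≤-Reasoning
  nonempty : a ∸ suc b ≢ 0
  nonempty len≡0 = n≮0 (subst (i <_) len≡0 i<len)

∈-between⁺ : ∀ {b a e} → b < e → e < a → e ∈ between b a
∈-between⁺ {b} {a} b<e e<a =
  subst (_∈ between b a) (m+[n∸m]≡n b<e) (∈-applyUpTo⁺ (suc b +_) (∸-monoˡ-< e<a b<e))

between-unique : ∀ b a → Unique (between b a)
between-unique b a =
  applyUpTo⁺₁ (suc b +_) (a ∸ suc b) (λ i<j _ eq → <⇒≢ i<j (+-cancelˡ-≡ (suc b) _ _ eq))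

-- The largest part of a partition (0 for the empty one): every part
-- inserted in front of it must exceed it.
largest : List ℕ → ℕ
largest []      = 0
largest (x ∷ _) = x

-- Interlaces v μ π: π = (μ₁, e₁, μ₂, e₂, …) with μᵢ > eᵢ > μᵢ₊₁.  For v = 0
-- every part of μ gets a partner (the last one above 0); for v = 1 the
-- last part of μ stays alone.
data Interlaces : ℕ → List ℕ → List ℕ → Set where
  none   : Interlaces 0 [] []
  single : ∀ m → Interlaces 1 (m ∷ []) (m ∷ [])
  insert : ∀ {v m e μ π} → largest μ < e → e < m → Interlaces v μ π
         → Interlaces v (m ∷ μ) (m ∷ e ∷ π)

extend : ℕ → List ℕ → List (List ℕ) → List (List ℕ)
extend m μ X = cartesianProductWith (λ e t → m ∷ e ∷ t) (between (largest μ) m) X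

fibre : ℕ → List ℕ → List (List ℕ)
fibre 0 []           = [] ∷ []
fibre 0 (m ∷ μ)      = extend m μ (fibre 0 μ)
fibre 1 (m ∷ [])     = (m ∷ []) ∷ []
fibre 1 (m ∷ m′ ∷ μ) = extend m (m′ ∷ μ) (fibre 1 (m′ ∷ μ))
fibre _ _            = []

∈-extend⁻ : ∀ {m μ X π} → π ∈ extend m μ X
          → Σ ℕ λ e → Σ (List ℕ) λ t → largest μ < e × e < m × t ∈ X × π ≡ m ∷ e ∷ t
∈-extend⁻ {m} {μ} {X} π∈ with ∈-cartesianProductWith⁻ (λ e t → m ∷ e ∷ t) (between (largest μ) m) X π∈
... | e , t , e∈ , t∈ , π≡ with ∈-between⁻ e∈
... | μ<e , e<m = e , t , μ<e , e<m , t∈ , π≡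

∈-extend⁺ : ∀ {m μ X e t} → largest μ < e → e < m → t ∈ X → (m ∷ e ∷ t) ∈ extend m μ X
∈-extend⁺ {m} μ<e e<m t∈ = ∈-cartesianProductWith⁺ (λ e t → m ∷ e ∷ t) (∈-between⁺ μ<e e<m) t∈

extend-unique : ∀ m μ {X} → Unique X → Unique (extend m μ X)
extend-unique m μ uX =
  cartesianProductWith⁺ (λ e t → m ∷ e ∷ t) prefix-injective (between-unique (largest μ) m) uX
  where
  prefix-injective : ∀ {e e′ t t′} → (m ∷ e ∷ t) ≡ (m ∷ e′ ∷ t′) → e ≡ e′ × t ≡ t′
  prefix-injective refl = refl , refl

length-extend : ∀ m μ X → length (extend m μ X) ≡ (m ∸ suc (largest μ)) * length X
length-extend m μ X =
  trans (length-cartesianProductWith (λ e t → m ∷ e ∷ t) (between (largest μ) m) X)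
        (cong (_* length X) (length-applyUpTo (suc (largest μ) +_) (m ∸ suc (largest μ))))

fibre-sound : ∀ v μ {π} → π ∈ fibre v μ → Interlaces v μ π
fibre-sound 0 [] (here refl) = none
fibre-sound 0 (m ∷ μ) π∈ with ∈-extend⁻ {m} {μ} π∈
... | e , t , μ<e , e<m , t∈ , refl = insert μ<e e<m (fibre-sound 0 μ t∈)
fibre-sound 1 (m ∷ []) (here refl) = single m
fibre-sound 1 (m ∷ m′ ∷ μ) π∈ with ∈-extend⁻ {m} {m′ ∷ μ} π∈
... | e , t , μ<e , e<m , t∈ , refl = insert μ<e e<m (fibre-sound 1 (m′ ∷ μ) t∈)

-- Extending the fibre over μ lands in the fibre over m ∷ μ (when the
-- fibre over μ is empty, so is its extension).
extend-fibre : ∀ v m μ {π} → π ∈ extend m μ (fibre v μ) → π ∈ fibre v (m ∷ μ)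
extend-fibre 0 m μ π∈ = π∈
extend-fibre 1 m (_ ∷ _) π∈ = π∈
extend-fibre 1 m [] π∈ with ∈-extend⁻ {m} {[]} π∈
... | _ , _ , _ , _ , () , _
extend-fibre (suc (suc v)) m μ π∈ with ∈-extend⁻ {m} {μ} π∈
... | _ , _ , _ , _ , () , _

fibre-complete : ∀ {v μ π} → Interlaces v μ π → π ∈ fibre v μ
fibre-complete none = here refl
fibre-complete (single m) = here refl
fibre-complete (insert {v} {m} {μ = μ} μ<e e<m r) =
  extend-fibre v m μ (∈-extend⁺ {m} {μ} μ<e e<m (fibre-complete r))

fibre-unique : ∀ v μ → Unique (fibre v μ)
fibre-unique 0 [] = [] ∷ []
fibre-unique 0 (m ∷ μ) = extend-unique m μ (fibre-unique 0 μ)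
fibre-unique 1 [] = []
fibre-unique 1 (m ∷ []) = [] ∷ []
fibre-unique 1 (m ∷ m′ ∷ μ) = extend-unique m (m′ ∷ μ) (fibre-unique 1 (m′ ∷ μ))
fibre-unique (suc (suc v)) μ = []

gap-choices : ∀ m m′ → m ∸ m′ ∸ 1 ≡ m ∸ suc m′
gap-choices m m′ = trans (∸-+-assoc m m′ 1) (cong (m ∸_) (+-comm m′ 1))

fibre-size₀ : ∀ μ → length (fibre 0 μ) ≡ ω22 μ
fibre-size₀ [] = refl
fibre-size₀ (m ∷ []) = length-extend m [] _
fibre-size₀ (m ∷ m′ ∷ μ) = begin
  length (fibre 0 (m ∷ m′ ∷ μ))
    ≡⟨ length-extend m (m′ ∷ μ) _ ⟩
  (m ∸ suc m′) * length (fibre 0 (m′ ∷ μ))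
    ≡⟨ cong₂ _*_ (sym (gap-choices m m′)) (fibre-size₀ (m′ ∷ μ)) ⟩
  (m ∸ m′ ∸ 1) * ((lastOf m′ μ ∸ 1) * gapProd (m′ ∷ μ))
    ≡⟨ x∙yz≈y∙xz (m ∸ m′ ∸ 1) (lastOf m′ μ ∸ 1) (gapProd (m′ ∷ μ)) ⟩
  (lastOf m′ μ ∸ 1) * ((m ∸ m′ ∸ 1) * gapProd (m′ ∷ μ))
    ∎
  where open ≡-Reasoning

fibre-size₁ : ∀ m μ → length (fibre 1 (m ∷ μ)) ≡ ω̃1 (m ∷ μ)
fibre-size₁ m [] = refl
fibre-size₁ m (m′ ∷ μ) =
  trans (length-extend m (m′ ∷ μ) _) (cong₂ _*_ (sym (gap-choices m m′)) (fibre-size₁ m′ μ))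

fibre-size : ∀ {l v} μ → v ≤ 1 → length μ ≡ l + v → length (fibre v μ) ≡ weight v μ
fibre-size μ z≤n _ = trans (fibre-size₀ μ) (sym (trans (+-identityʳ _) (+-identityʳ _)))
fibre-size (m ∷ μ) (s≤s z≤n) _ = trans (fibre-size₁ m μ) (sym (+-identityʳ _))
fibre-size {l} [] (s≤s z≤n) len = contradiction (trans len (+-comm l 1)) 0≢1+n

oddParts : List ℕ → List ℕ
oddParts []           = []
oddParts (x ∷ [])     = x ∷ []
oddParts (x ∷ _ ∷ xs) = x ∷ oddParts xs

largest-oddParts : ∀ π → largest (oddParts π) ≡ largest π
largest-oddParts []           = refl
largest-oddParts (x ∷ [])     = refl
largest-oddParts (x ∷ _ ∷ xs) = refl

oddParts-positive : ∀ π → Positive π → Positive (oddParts π)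
oddParts-positive [] _ = []
oddParts-positive (_ ∷ []) pos = pos
oddParts-positive (_ ∷ _ ∷ π) (0<x ∷ _ ∷ pos) = 0<x ∷ oddParts-positive π pos

-- μ is determined by π: this makes fibres over distinct μ disjoint.
interlaces-oddParts : ∀ {v μ π} → Interlaces v μ π → oddParts π ≡ μ
interlaces-oddParts none = refl
interlaces-oddParts (single m) = refl
interlaces-oddParts (insert {m = m} _ _ r) = cong (m ∷_) (interlaces-oddParts r)

interlaces-oddSum : ∀ {v μ π} → Interlaces v μ π → oddSum π ≡ sum μ
interlaces-oddSum none = refl
interlaces-oddSum (single m) = refl
interlaces-oddSum (insert {m = m} _ _ r) = cong (m +_) (interlaces-oddSum r)

interlaces-largest : ∀ {v μ π} → Interlaces v μ π → largest π ≡ largest μ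
interlaces-largest none = refl
interlaces-largest (single m) = refl
interlaces-largest (insert _ _ _) = refl

interlaces-length : ∀ {v μ π} → Interlaces v μ π → length π + v ≡ 2 * length μ
interlaces-length none = refl
interlaces-length (single m) = refl
interlaces-length (insert {μ = μ} _ _ r) =
  trans (cong (2 +_) (interlaces-length r)) (sym (*-suc 2 (length μ)))

cons-decreasing : ∀ {e π} → largest π < e → Decreasing π → Decreasing (e ∷ π)
cons-decreasing {π = []} _ _ = [-]
cons-decreasing {π = _ ∷ _} π<e dec = π<e ∷ dec

interlaces-decreasing : ∀ {v μ π} → Interlaces v μ π → Decreasing π
interlaces-decreasing none = []
interlaces-decreasing (single m) = [-]
interlaces-decreasing (insert μ<e e<m r) =
  e<m ∷ cons-decreasing (subst (_< _) (sym (interlaces-largest r)) μ<e) (interlaces-decreasing r)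

-- Inserted parts exceed a nonnegative bound, so they are positive.
interlaces-positive : ∀ {v μ π} → Interlaces v μ π → Positive μ → Positive π
interlaces-positive none _ = []
interlaces-positive (single m) pos = pos
interlaces-positive (insert μ<e _ r) (0<m ∷ pos) = 0<m ∷ ≤-<-trans z≤n μ<e ∷ interlaces-positive r pos

-- Two parts of μ enclose a part of π, so they differ by at least 2.
interlaces-gapped : ∀ {v μ π} → Interlaces v μ π → Gapped μ
interlaces-gapped none = []
interlaces-gapped (single m) = [-]
interlaces-gapped (insert {μ = []} _ _ _) = [-]
interlaces-gapped (insert {μ = _ ∷ _} μ<e e<m r) = ≤-trans (s≤s μ<e) e<m ∷ interlaces-gapped r

-- The last part of μ is ≥ 2 when it encloses a positive part (v = 0),
-- and ≥ 1 anyway.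
interlaces-last : ∀ {v μ π} → Interlaces v μ π → Positive μ → LastGe (2 ∸ v) μ
interlaces-last none _ = tt
interlaces-last (single m) (0<m ∷ []) = 0<m
interlaces-last {v} (insert {μ = []} μ<e e<m _) _ = ≤-trans (m∸n≤m 2 v) (≤-trans (s≤s μ<e) e<m)
interlaces-last (insert {μ = _ ∷ _} _ _ r) (_ ∷ pos) = interlaces-last r pos

below-head : ∀ {b π} → 0 < b → Decreasing (b ∷ π) → largest π < b
below-head {π = []} 0<b _ = 0<b
below-head {π = _ ∷ _} _ (c<b ∷ _) = c<b

oddParts-interlaces : ∀ {v} → v ≤ 1 → ∀ π k → Positive π → Decreasing π
                    → length π + v ≡ 2 * k → Interlaces v (oddParts π) π
oddParts-interlaces z≤n [] k _ _ _ = none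
oddParts-interlaces (s≤s z≤n) [] k _ _ len = contradiction (sym len) (even≢odd k 0)
oddParts-interlaces z≤n (x ∷ []) k _ _ len = contradiction (sym len) (even≢odd k 0)
oddParts-interlaces (s≤s z≤n) (x ∷ []) k _ _ _ = single x
oddParts-interlaces v≤1 (a ∷ b ∷ π) zero _ _ ()
oddParts-interlaces v≤1 (a ∷ b ∷ π) (suc k) (_ ∷ 0<b ∷ pos) (b<a ∷ dec) len =
  insert (subst (_< b) (sym (largest-oddParts π)) (below-head 0<b dec)) b<a
         (oddParts-interlaces v≤1 π k pos (Linked.tail dec)
            (suc-injective (suc-injective (trans len (*-suc 2 k)))))

double-sum : ∀ l v → 2 * (l + v) ≡ (2 * l + v) + v
double-sum = solve-∀

decreasing⇒partition : ∀ {π} → Positive π → Decreasing π → IsPartition π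
decreasing⇒partition pos dec = pos , Linked.map <⇒≤ dec

interlaced-distinct : ∀ {l v μ π} → InP (l + v) (2 ∸ v) μ → Interlaces v μ π → InD (2 * l + v) π
interlaced-distinct {l} {v} {μ} {π} ((pos , _) , len , _ , _) r =
  decreasing⇒partition (interlaces-positive r pos) dec , dec , +-cancelʳ-≡ v _ _ (begin
    length π + v      ≡⟨ interlaces-length r ⟩
    2 * length μ      ≡⟨ cong (2 *_) len ⟩
    2 * (l + v)       ≡⟨ double-sum l v ⟩
    (2 * l + v) + v   ∎)
  where
  open ≡-Reasoning
  dec : Decreasing π
  dec = interlaces-decreasing r

distinct-interlaced : ∀ {l v π} → v ≤ 1 → InD (2 * l + v) π
                    → InP (l + v) (2 ∸ v) (oddParts π) × Interlaces v (oddParts π) π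
distinct-interlaced {l} {v} {π} v≤1 ((pos , _) , dec , len) =
  ((posμ , Linked.map (λ {_} {b} 2+b≤a → ≤-trans (m≤n+m b 2) 2+b≤a) gapped) , lenμ ,
   interlaces-last r posμ , gapped) , r
  where
  lenπ : length π + v ≡ 2 * (l + v)
  lenπ = trans (cong (_+ v) len) (sym (double-sum l v))
  r : Interlaces v (oddParts π) π
  r = oddParts-interlaces v≤1 π (l + v) pos dec lenπ
  gapped : Gapped (oddParts π)
  gapped = interlaces-gapped r
  posμ : Positive (oddParts π)
  posμ = oddParts-positive π pos
  lenμ : length (oddParts π) ≡ l + v
  lenμ = *-cancelˡ-≡ _ _ 2 (trans (sym (interlaces-length r)) lenπ)

fibres-members : ∀ {l v n L₂} → v ≤ 1
  → ((μ : List ℕ) → (μ ∈ L₂) ⇔ (InP (l + v) (2 ∸ v) μ × sum μ ≡ n))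
  → ∀ π → (π ∈ concatMap (fibre v) L₂) ⇔ (InD (2 * l + v) π × oddSum π ≡ n)
fibres-members {v = v} {L₂ = L₂} v≤1 inL₂ π = mk⇔ to from
  where
  to : π ∈ concatMap (fibre v) L₂ → InD _ π × oddSum π ≡ _
  to π∈ with find (∈-concatMap⁻ (fibre v) {L₂} π∈)
  ... | μ , μ∈ , π∈fibre with Equivalence.to (inL₂ μ) μ∈
  ... | inP , sumμ = interlaced-distinct inP r , trans (interlaces-oddSum r) sumμ
    where
    r : Interlaces v μ π
    r = fibre-sound v μ π∈fibre
  from : InD _ π × oddSum π ≡ _ → π ∈ concatMap (fibre v) L₂
  from (inD , oddSumπ) with distinct-interlaced v≤1 inD
  ... | inP , r = ∈-concatMap⁺ (fibre v)
        (lose (Equivalence.from (inL₂ _) (inP , trans (sym (interlaces-oddSum r)) oddSumπ))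
              (fibre-complete r))

theorem9 : (l v : ℕ) → v ≤ 1 → (n : ℕ) → (L₁ L₂ : List (List ℕ))
    → Unique L₁ → ((π : List ℕ) → (π ∈ L₁) ⇔ (InD (2 * l + v) π × oddSum π ≡ n))
    → Unique L₂ → ((π : List ℕ) → (π ∈ L₂) ⇔ (InP (l + v) (2 ∸ v) π × sum π ≡ n))
    → length L₁ ≡ sum (map (weight v) L₂)
theorem9 l v v≤1 n L₁ L₂ u₁ inL₁ u₂ inL₂ = begin
  length L₁                         ≡⟨ sameLength u₁ fibres-unique same-members ⟩
  length (concatMap (fibre v) L₂)   ≡⟨ length-concatMap (fibre v) (weight v) sizes ⟩
  sum (map (weight v) L₂)           ∎
  where
  open ≡-Reasoning
  fibres-unique : Unique (concatMap (fibre v) L₂)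
  fibres-unique = concatMap-unique (fibre v) oddParts
    (λ μ _ π∈ → interlaces-oddParts (fibre-sound v μ π∈)) u₂ (λ μ _ → fibre-unique v μ)
  same-members : ∀ {π} → (π ∈ L₁) ⇔ (π ∈ concatMap (fibre v) L₂)
  same-members {π} = ⇔-trans (inL₁ π) (⇔-sym (fibres-members v≤1 inL₂ π))
  sizes : ∀ μ → μ ∈ L₂ → length (fibre v μ) ≡ weight v μ
  sizes μ μ∈ with Equivalence.to (inL₂ μ) μ∈
  ... | (_ , lenμ , _) , _ = fibre-size μ v≤1 lenμ
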